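{- Let $\mathcal{H}$ be an $r$-uniform hypergraph with the property that for every longest Berge path $Q$ of $\mathcal{H}$, every edge containing a terminal vertex of $Q$ is a defining edge of $Q$. Let $P=v_0e_1v_1e_2\cdots v_{k-1}e_kv_k$ be a longest Berge path and $W=\{v_1,\dots,v_k\}$. Then: (i) if $v_i\in e_1\cap W$ and $e_i\setminus W=\emptyset$ for some $1\le i\le k$, then $\mathcal{H}$ contains a Berge cycle of length at least $r$; (ii) if $v_i\in e_1\cap W$ and $e_i\setminus W\ne\emptyset$ for some $1\le i\le k$, then $e_i$ is the first edge of some longest Berge path of $\mathcal{H}$, and $N(e_i\setminus W)\subseteq\{e_1,\dots,e_k\}$; (iii) if $v_i\in e_1\cap W$ and $(e_i\cap e_j)\setminus W\ne\emptyset$ for some $1\le i<j\le k$, then $N(v_{j-1})\subseteq\{e_1,\dots,e_k\}$; (iv) if $v_j\in e_1\cap W$ and $(e_i\cap e_j)\setminus W\ne\emptyset$ for some $1\le i<j\le k$, then $N(v_i)\subseteq\{e_1,\dots,e_k\}$.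
   Context: Hypergraphs are simple. A Berge path of length $k$ is an alternating sequence $v_0e_1v_1\cdots v_{k-1}e_kv_k$ of distinct vertices and distinct edges with $v_{i-1},v_i\in e_i$; $v_0,v_k$ are its terminal vertices, $e_1$ its first edge, $e_1,\dots,e_k$ its defining edges. A Berge cycle of length $k$ is an alternating sequence $v_0e_1v_1\cdots v_{k-1}e_kv_0$ of distinct vertices and distinct edges with $v_{i-1},v_i\in e_i$ (indices mod $k$). For $S\subseteq V(\mathcal{H})$, $N(S)=\{e\in E(\mathcal{H}): e\cap S\ne\emptyset\}$, and $N(v)=N(\{v\})$. -}

module Defs where

open import Data.Nat using (ℕ; zero; suc; _≤_)
open import Data.Fin using (Fin; zero; suc; inject₁; fromℕ; _<_)
open import Data.Fin.Subset using (Subset; _∈_; _∉_; ∣_∣)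
open import Data.Sum using (_⊎_)
open import Data.Product using (Σ; ∃; ∃-syntax; _×_; _,_)
open import Function.Definitions using (Injective)
open import Relation.Binary.PropositionalEquality using (_≡_)
open import Relation.Nullary using (¬_)

record Hypergraph : Set where
  field
    n : ℕ
    m : ℕ
    E : Fin m → Subset n
    simple : Injective _≡_ _≡_ E
open Hypergraph public

Uniform : ℕ → Hypergraph → Set
Uniform r H = ∀ f → ∣ E H f ∣ ≡ r

-- Berge path of length k:  v₀ e₁ v₁ ⋯ e_k v_k.
-- vert i = v_i (i = 0..k);  edge i = e_{i+1} (0-based, i = 0..k-1).
record BergePath (H : Hypergraph) (k : ℕ) : Set where
  field
    vert : Fin (suc k) → Fin (n H)
    edge : Fin k → Fin (m H)
    vert-inj : Injective _≡_ _≡_ vert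
    edge-inj : Injective _≡_ _≡_ edge
    inc : ∀ i → (vert (inject₁ i) ∈ E H (edge i)) × (vert (suc i) ∈ E H (edge i))
open BergePath public

IsLongest : ∀ {H k} → BergePath H k → Set
IsLongest {H} {k} _ = ∀ l → BergePath H l → l ≤ k

IsTerminal : ∀ {H k} → BergePath H k → Fin (n H) → Set
IsTerminal {k = k} P x = (vert P zero ≡ x) ⊎ (vert P (fromℕ k) ≡ x)

IsDefiningEdge : ∀ {H k} → BergePath H k → Fin (m H) → Set
IsDefiningEdge P f = ∃[ i ] edge P i ≡ f

-- Berge cycle of length suc k:  v₀ e₀ v₁ ⋯ v_k e_k v₀  (0-based edges),
-- edge i contains vert i and vert (i+1 mod (suc k)).
record BergeCycle (H : Hypergraph) (k : ℕ) : Set where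
  field
    cvert : Fin (suc k) → Fin (n H)
    cedge : Fin (suc k) → Fin (m H)
    cvert-inj : Injective _≡_ _≡_ cvert
    cedge-inj : Injective _≡_ _≡_ cedge
    cinc : ∀ (i : Fin k) → (cvert (inject₁ i) ∈ E H (cedge (inject₁ i)))
                         × (cvert (suc i) ∈ E H (cedge (inject₁ i)))
    cclose : (cvert (fromℕ k) ∈ E H (cedge (fromℕ k))) × (cvert zero ∈ E H (cedge (fromℕ k)))

HasCycleAtLeast : Hypergraph → ℕ → Set
HasCycleAtLeast H r = ∃[ k ] (r ≤ suc k × BergeCycle H k)

TerminalEdgesDefining : Hypergraph → Set
TerminalEdgesDefining H =
  ∀ l (Q : BergePath H l) → IsLongest Q →
  ∀ x f → IsTerminal Q x → x ∈ E H f → IsDefiningEdge Q f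

InW : ∀ {H k} → BergePath H k → Fin (n H) → Set
InW P x = ∃[ i ] vert P (suc i) ≡ x

NbhdInPath : ∀ {H k} → BergePath H k → (Fin (n H) → Set) → Set
NbhdInPath {H} P S = ∀ (f : Fin (m H)) → (∃[ x ] (S x × x ∈ E H f)) → IsDefiningEdge P f

IsFirstEdgeOfLongest : (H : Hypergraph) → Fin (m H) → Set
IsFirstEdgeOfLongest H f = ∃[ l ] Σ (BergePath H (suc l)) (λ Q → IsLongest Q × edge Q zero ≡ f)

module Submission where

-- Every part comes from re-routing P through its first edge e₁. Since vᵢ ∈ e₁, the walk
-- vᵢ e₁ v₁ e₂ v₂ ⋯ e_{i-1} v_{i-1} (just vᵢ when i = 1) ends in a vertex of eᵢ, so it can take
-- over the role of eᵢ in P.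
-- (i) If v_t is the last vertex of P in eᵢ, the segment v_t ⋯ vᵢ of P, this walk and the edge eᵢ
--     close a cycle through v₁, …, v_t. As eᵢ ⊆ W, all r vertices of eᵢ lie on it.
-- (ii)–(iv) A vertex u ∈ eᵢ ∖ W (lying also in eⱼ for (iii), (iv)) can be spliced in, giving a
--     Berge path on the vertices W ∪ {u} and on the edges of P that starts with u eᵢ, at v_{j-1},
--     resp. at vᵢ. It is as long as P, hence longest, so every edge at its start is an edge of P.
-- Distinctness of the vertices and edges of these walks follows by identifying their vertex and
-- edge lists, up to permutation, with intervals of indices along P.

open import Defs
open import Data.Nat using (ℕ; zero; suc; _+_; _≤_; z≤n; s≤s)
open import Data.Nat.Properties
  using (+-suc; +-identityʳ; ≤-refl; ≤-reflexive; ≤-trans; <⇒≤; n≤1+n; m≤m+n; <-irrefl; <⇒≱; ≤∧≢⇒<; ≮⇒≥; m≤n⇒∃[o]m+o≡n; m≤n⇒m<n∨m≡n; ≤-pred; <-trans; module ≤-Reasoning)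
import Data.Nat as ℕ
open import Data.Fin using (Fin; zero; suc; toℕ; inject₁; fromℕ; _<_)
open import Data.Vec using ([]; _∷_)
open import Data.Fin.Subset using (Subset; _∈_; ∣_∣; _∪_; ⁅_⁆; ⋃; inside; outside)
open import Data.Fin.Subset.Properties using (∣⊥∣≡0; ∣⁅x⁆∣≡1; p⊆q⇒∣p∣≤∣q∣; x∈p∪q⁺; x∈⁅x⁆; _∈?_)
open import Data.Fin.Properties using (toℕ<n; toℕ-inject₁)
open import Data.List using (List; []; _∷_; _++_; map; [_]; length)
open import Data.List.Properties using (map-++; ++-assoc; length-map)
open import Data.List.Membership.Propositional using () renaming (_∈_ to _∈ˡ_)
open import Data.List.Membership.Propositional.Properties using (∈-map⁻; ∈-map⁺)
open import Data.List.Relation.Unary.Any using (here; there)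
import Data.List.Relation.Unary.All as All
import Data.List.Relation.Unary.All.Properties as All
open import Data.List.Relation.Unary.Unique.Propositional using (Unique; []; _∷_)
open import Data.List.Relation.Binary.Permutation.Propositional
  using (_↭_; prep; ↭-refl; ↭-sym; ↭-trans; ↭-reflexive; ↭⇒↭ₛ; module PermutationReasoning)
open import Data.List.Relation.Binary.Permutation.Propositional.Properties using (++⁺; ++⁺ˡ; ++⁺ʳ; ++-comm; ∷↭∷ʳ; shift; ∈-resp-↭; ↭-length)
import Data.List.Relation.Binary.Permutation.Setoid.Properties as SetoidPermutation
open import Data.Empty using (⊥-elim)
open import Data.Product using (Σ; ∃-syntax; _×_; _,_; proj₁; proj₂)
open import Data.Sum using (inj₁; inj₂)
open import Function using (_∘_)
open import Function.Definitions using (Injective)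
open import Relation.Binary.Definitions using (_Respects_)
open import Relation.Binary.PropositionalEquality using (_≡_; _≢_; refl; sym; trans; cong; subst; subst₂; setoid)
open import Relation.Binary.Properties.Setoid using (≉-sym; ≉-resp₂)
open import Relation.Nullary using (¬_; Dec; yes; no)

Unique-resp-↭ : ∀ {A : Set} → Unique {A = A} Respects _↭_
Unique-resp-↭ {A} p = AllPairs-resp-↭ (≉-sym (setoid A)) (≉-resp₂ (setoid A)) (↭⇒↭ₛ p)
  where open SetoidPermutation (setoid A)

Unique-map⁺ : ∀ {A B : Set} {g : A → B} {xs} →
              (∀ {x y} → x ∈ˡ xs → y ∈ˡ xs → g x ≡ g y → x ≡ y) → Unique xs → Unique (map g xs)
Unique-map⁺ inj [] = []
Unique-map⁺ inj (x∉xs ∷ xs!) =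
  All.map⁺ (All.tabulate λ y∈xs gx≡gy → All.lookup x∉xs y∈xs (inj (here refl) (there y∈xs) gx≡gy))
  ∷ Unique-map⁺ (λ x∈ y∈ → inj (there x∈) (there y∈)) xs!

injective-∷ : ∀ {A : Set} {n} {g : Fin (suc n) → A} →
              (∀ i → g zero ≢ g (suc i)) → Injective _≡_ _≡_ (g ∘ suc) → Injective _≡_ _≡_ g
injective-∷ fresh inj {zero}  {zero}  _  = refl
injective-∷ fresh inj {zero}  {suc j} eq = ⊥-elim (fresh j eq)
injective-∷ fresh inj {suc i} {zero}  eq = ⊥-elim (fresh i (sym eq))
injective-∷ fresh inj {suc i} {suc j} eq = cong suc (inj eq)

range : ℕ → ℕ → List ℕ
range a zero    = []
range a (suc d) = a ∷ range (suc a) d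

∈-range⁻ : ∀ {x} a d → x ∈ˡ range a d → a ≤ x × x ℕ.< a + d
∈-range⁻ a (suc d) (here refl) = ≤-refl , subst (a ℕ.<_) (sym (+-suc a d)) (s≤s (m≤m+n a d))
∈-range⁻ {x} a (suc d) (there x∈) with ∈-range⁻ (suc a) d x∈
... | a<x , x<a+d = <⇒≤ a<x , subst (x ℕ.<_) (sym (+-suc a d)) x<a+d

∈-range⁺ : ∀ {x} a d → a ≤ x → x ℕ.< a + d → x ∈ˡ range a d
∈-range⁺ {x} a zero    a≤x x<a = ⊥-elim (<⇒≱ (subst (x ℕ.<_) (+-identityʳ a) x<a) a≤x)
∈-range⁺ {x} a (suc d) a≤x x<a+d with a ℕ.≟ x
... | yes refl = here refl
... | no  a≢x  = there (∈-range⁺ (suc a) d (≤∧≢⇒< a≤x a≢x) (subst (x ℕ.<_) (+-suc a d) x<a+d))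

range-Unique : ∀ a d → Unique (range a d)
range-Unique a zero    = []
range-Unique a (suc d) = All.tabulate (λ x∈ a≡x → <-irrefl a≡x (proj₁ (∈-range⁻ (suc a) d x∈))) ∷ range-Unique (suc a) d

length-range : ∀ a d → length (range a d) ≡ d
length-range a zero    = refl
length-range a (suc d) = cong suc (length-range (suc a) d)

range-++ : ∀ a d e → range a d ++ range (a + d) e ≡ range a (d + e)
range-++ a zero    e rewrite +-identityʳ a = refl
range-++ a (suc d) e rewrite +-suc a d = cong (a ∷_) (range-++ (suc a) d e)

range-∷ʳ : ∀ a d → range a d ++ [ a + d ] ≡ range a (suc d)
range-∷ʳ a zero    rewrite +-identityʳ a = refl
range-∷ʳ a (suc d) rewrite +-suc a d = cong (a ∷_) (range-∷ʳ (suc a) d)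

module _ {A : Set} (g : ℕ → A) where

  Unique-map-range : ∀ {B} → (∀ {x y} → x ℕ.< B → y ℕ.< B → g x ≡ g y → x ≡ y) →
                     ∀ a d → a + d ≤ B → Unique (map g (range a d))
  Unique-map-range inj a d a+d≤B = Unique-map⁺ (λ x∈ y∈ → inj (below x∈) (below y∈)) (range-Unique a d)
    where
    below : ∀ {x} → x ∈ˡ range a d → x ℕ.< _
    below x∈ = ≤-trans (proj₂ (∈-range⁻ a d x∈)) a+d≤B

  ↭-range-++ : ∀ {xs ys a b d e} → a + d ≡ b →
               xs ↭ map g (range a d) → ys ↭ map g (range b e) → xs ++ ys ↭ map g (range a (d + e))
  ↭-range-++ {a = a} {d = d} {e} refl xs↭ ys↭ =
    ↭-trans (++⁺ xs↭ ys↭) (↭-reflexive (trans (sym (map-++ g (range a d) _)) (cong (map g) (range-++ a d e))))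

  ↭-range-++ᶜ : ∀ {xs ys a b d e} → a + d ≡ b →
                xs ↭ map g (range a d) → ys ↭ map g (range b e) → ys ++ xs ↭ map g (range a (d + e))
  ↭-range-++ᶜ {xs} {ys} eq xs↭ ys↭ = ↭-trans (++-comm ys xs) (↭-range-++ eq xs↭ ys↭)

  ↭-range-∷ : ∀ a d → g (a + d) ∷ map g (range a d) ↭ map g (range a (suc d))
  ↭-range-∷ a d = ↭-trans (∷↭∷ʳ _ _)
    (↭-reflexive (trans (sym (map-++ g (range a d) _)) (cong (map g) (range-∷ʳ a d))))

∣p∪q∣≤∣p∣+∣q∣ : ∀ {n} (p q : Subset n) → ∣ p ∪ q ∣ ≤ ∣ p ∣ + ∣ q ∣
∣p∪q∣≤∣p∣+∣q∣ []            []            = z≤n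
∣p∪q∣≤∣p∣+∣q∣ (outside ∷ p) (outside ∷ q) = ∣p∪q∣≤∣p∣+∣q∣ p q
∣p∪q∣≤∣p∣+∣q∣ (outside ∷ p) (inside ∷ q)  rewrite +-suc ∣ p ∣ ∣ q ∣ = s≤s (∣p∪q∣≤∣p∣+∣q∣ p q)
∣p∪q∣≤∣p∣+∣q∣ (inside ∷ p)  (outside ∷ q) = s≤s (∣p∪q∣≤∣p∣+∣q∣ p q)
∣p∪q∣≤∣p∣+∣q∣ (inside ∷ p)  (inside ∷ q)  rewrite +-suc ∣ p ∣ ∣ q ∣ = s≤s (≤-trans (∣p∪q∣≤∣p∣+∣q∣ p q) (n≤1+n _))

∣⋃⁅xs⁆∣≤length : ∀ {n} (xs : List (Fin n)) → ∣ ⋃ (map ⁅_⁆ xs) ∣ ≤ length xs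
∣⋃⁅xs⁆∣≤length {n} []       = subst (_≤ 0) (sym (∣⊥∣≡0 n)) z≤n
∣⋃⁅xs⁆∣≤length     (x ∷ xs) = begin
  ∣ ⁅ x ⁆ ∪ ⋃ (map ⁅_⁆ xs) ∣        ≤⟨ ∣p∪q∣≤∣p∣+∣q∣ ⁅ x ⁆ _ ⟩
  ∣ ⁅ x ⁆ ∣ + ∣ ⋃ (map ⁅_⁆ xs) ∣    ≡⟨ cong (_+ _) (∣⁅x⁆∣≡1 x) ⟩
  suc ∣ ⋃ (map ⁅_⁆ xs) ∣            ≤⟨ s≤s (∣⋃⁅xs⁆∣≤length xs) ⟩
  suc (length xs)                   ∎
  where open ≤-Reasoning

∈⋃⁅xs⁆ : ∀ {n} {x : Fin n} {xs} → x ∈ˡ xs → x ∈ ⋃ (map ⁅_⁆ xs)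
∈⋃⁅xs⁆ (here refl) = x∈p∪q⁺ (inj₁ (x∈⁅x⁆ _))
∈⋃⁅xs⁆ (there x∈)  = x∈p∪q⁺ (inj₂ (∈⋃⁅xs⁆ x∈))

∣p∣≤length : ∀ {n} {p : Subset n} xs → (∀ {x} → x ∈ p → x ∈ˡ xs) → ∣ p ∣ ≤ length xs
∣p∣≤length xs p⊆xs = ≤-trans (p⊆q⇒∣p∣≤∣q∣ (∈⋃⁅xs⁆ ∘ p⊆xs)) (∣⋃⁅xs⁆∣≤length xs)

lastWitness : ∀ {Q : ℕ → Set} → (∀ s → Dec (Q s)) → ∀ {a} N → a ≤ N → Q a →
              ∃[ t ] a ≤ t × t ≤ N × Q t × (∀ {s} → t ℕ.< s → s ≤ N → ¬ Q s)
lastWitness Q? zero z≤n qa = zero , z≤n , z≤n , qa , λ 0<s s≤0 → ⊥-elim (<⇒≱ 0<s s≤0)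
lastWitness {Q} Q? {a} (suc N) a≤1+N qa with Q? (suc N) | m≤n⇒m<n∨m≡n a≤1+N
... | yes q1+N | _             = suc N , a≤1+N , ≤-refl , q1+N , λ N<s s≤N → ⊥-elim (<⇒≱ N<s s≤N)
... | no ¬q1+N | inj₂ refl     = ⊥-elim (¬q1+N qa)
... | no ¬q1+N | inj₁ (s≤s a≤N) with lastWitness Q? N a≤N qa
...   | t , a≤t , t≤N , qt , last = t , a≤t , ≤-trans t≤N (n≤1+n N) , qt , beyond
  where
  beyond : ∀ {s} → t ℕ.< s → s ≤ suc N → ¬ Q s
  beyond t<s s≤1+N with m≤n⇒m<n∨m≡n s≤1+N
  ... | inj₁ (s≤s s≤N) = last t<s s≤N
  ... | inj₂ refl      = ¬q1+N

module Walks (H : Hypergraph) where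

  private
    V  = Fin (n H)
    Ed = Fin (m H)

  -- Walk a b vs es: a Berge walk from a to b; vs lists its vertices after a, es its edges, in order.
  data Walk : V → V → List V → List Ed → Set where
    []   : ∀ {a} → Walk a a [] []
    step : ∀ {a b c vs es e} → a ∈ E H e → b ∈ E H e → Walk b c vs es → Walk a c (b ∷ vs) (e ∷ es)

  private
    variable
      a b c : V
      vs ws : List V
      es fs : List Ed

  infixr 5 _++ʷ_

  _++ʷ_ : Walk a b vs es → Walk b c ws fs → Walk a c (vs ++ ws) (es ++ fs)
  []             ++ʷ w′ = w′
  step a∈ b∈ w   ++ʷ w′ = step a∈ b∈ (w ++ʷ w′)

  reverseʷ : Walk a b vs es → ∃[ vs′ ] ∃[ es′ ] Walk b a vs′ es′ × b ∷ vs′ ↭ a ∷ vs × es′ ↭ es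
  reverseʷ [] = [] , [] , [] , ↭-refl , ↭-refl
  reverseʷ {a} (step {b = b} {e = e} a∈ b∈ w) with reverseʷ w
  ... | vs′ , es′ , w′ , vs′↭ , es′↭ =
    vs′ ++ [ a ] , es′ ++ [ e ] , w′ ++ʷ step b∈ a∈ [] ,
    ↭-trans (↭-sym (∷↭∷ʳ a _)) (prep a vs′↭) ,
    ↭-trans (↭-sym (∷↭∷ʳ e es′)) (prep e es′↭)

  length-vertices : Walk a b vs es → length vs ≡ length es
  length-vertices []           = refl
  length-vertices (step _ _ w) = cong suc (length-vertices w)

  vertexAt : Walk a b vs es → Fin (suc (length es)) → V
  vertexAt {a} _            zero    = a
  vertexAt     (step _ _ w) (suc i) = vertexAt w i

  edgeAt : Walk a b vs es → Fin (length es) → Ed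
  edgeAt (step {e = e} _ _ _) zero    = e
  edgeAt (step _ _ w)         (suc i) = edgeAt w i

  edgeAt-zero : ∀ {e} (w : Walk a b vs (e ∷ es)) → edgeAt w zero ≡ e
  edgeAt-zero (step _ _ _) = refl

  vertexAt-last : (w : Walk a b vs es) → vertexAt w (fromℕ (length es)) ≡ b
  vertexAt-last []           = refl
  vertexAt-last (step _ _ w) = vertexAt-last w

  vertexAt-incident : (w : Walk a b vs es) (i : Fin (length es)) →
                      vertexAt w (inject₁ i) ∈ E H (edgeAt w i) × vertexAt w (suc i) ∈ E H (edgeAt w i)
  vertexAt-incident (step a∈ b∈ w) zero    = a∈ , b∈
  vertexAt-incident (step _ _ w)   (suc i) = vertexAt-incident w i

  vertexAt-∈ : (w : Walk a b vs es) (i : Fin (suc (length es))) → vertexAt w i ∈ˡ a ∷ vs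
  vertexAt-∈ w            zero    = here refl
  vertexAt-∈ (step _ _ w) (suc i) = there (vertexAt-∈ w i)

  edgeAt-∈ : (w : Walk a b vs es) (i : Fin (length es)) → edgeAt w i ∈ˡ es
  edgeAt-∈ (step _ _ w) zero    = here refl
  edgeAt-∈ (step _ _ w) (suc i) = there (edgeAt-∈ w i)

  vertexAt-injective : (w : Walk a b vs es) → Unique (a ∷ vs) → Injective _≡_ _≡_ (vertexAt w)
  vertexAt-injective []           _            {zero} {zero} _ = refl
  vertexAt-injective (step _ _ w) (a∉ ∷ vs!) =
    injective-∷ (λ i → All.lookup a∉ (vertexAt-∈ w i)) (vertexAt-injective w vs!)

  edgeAt-injective : (w : Walk a b vs es) → Unique es → Injective _≡_ _≡_ (edgeAt w)
  edgeAt-injective []           _ {()}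
  edgeAt-injective (step _ _ w) (e∉ ∷ es!) =
    injective-∷ (λ i → All.lookup e∉ (edgeAt-∈ w i)) (edgeAt-injective w es!)

  toPath : (w : Walk a b vs es) → Unique (a ∷ vs) → Unique es → BergePath H (length es)
  toPath w vs! es! = record
    { vert     = vertexAt w
    ; edge     = edgeAt w
    ; vert-inj = vertexAt-injective w vs!
    ; edge-inj = edgeAt-injective w es!
    ; inc      = vertexAt-incident w
    }

  closedEdgeAt : Walk a b vs es → Ed → Fin (suc (length es)) → Ed
  closedEdgeAt []                   e zero    = e
  closedEdgeAt (step {e = e₀} _ _ _) _ zero    = e₀
  closedEdgeAt (step _ _ w)         e (suc i) = closedEdgeAt w e i

  closedEdgeAt-inject₁ : (w : Walk a b vs es) (e : Ed) (i : Fin (length es)) →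
                         closedEdgeAt w e (inject₁ i) ≡ edgeAt w i
  closedEdgeAt-inject₁ (step _ _ w) e zero    = refl
  closedEdgeAt-inject₁ (step _ _ w) e (suc i) = closedEdgeAt-inject₁ w e i

  closedEdgeAt-last : (w : Walk a b vs es) (e : Ed) → closedEdgeAt w e (fromℕ (length es)) ≡ e
  closedEdgeAt-last []           e = refl
  closedEdgeAt-last (step _ _ w) e = closedEdgeAt-last w e

  closedEdgeAt-∈ : (w : Walk a b vs es) (e : Ed) (i : Fin (suc (length es))) → closedEdgeAt w e i ∈ˡ es ++ [ e ]
  closedEdgeAt-∈ []           e zero    = here refl
  closedEdgeAt-∈ (step _ _ w) e zero    = here refl
  closedEdgeAt-∈ (step _ _ w) e (suc i) = there (closedEdgeAt-∈ w e i)

  closedEdgeAt-injective : (w : Walk a b vs es) (e : Ed) → Unique (es ++ [ e ]) → Injective _≡_ _≡_ (closedEdgeAt w e)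
  closedEdgeAt-injective []           e _ {zero} {zero} _ = refl
  closedEdgeAt-injective (step _ _ w) e (e₀∉ ∷ es!) =
    injective-∷ (λ i → All.lookup e₀∉ (closedEdgeAt-∈ w e i)) (closedEdgeAt-injective w e es!)

  toCycle : ∀ {e} (w : Walk a b vs es) → b ∈ E H e → a ∈ E H e →
            Unique (a ∷ vs) → Unique (e ∷ es) → BergeCycle H (length es)
  toCycle {a} {b} {e = e} w b∈ a∈ vs! e∷es! = record
    { cvert     = vertexAt w
    ; cedge     = closedEdgeAt w e
    ; cvert-inj = vertexAt-injective w vs!
    ; cedge-inj = closedEdgeAt-injective w e (Unique-resp-↭ (∷↭∷ʳ e _) e∷es!)
    ; cinc      = λ i → subst (λ g → _ ∈ E H g × _ ∈ E H g) (sym (closedEdgeAt-inject₁ w e i)) (vertexAt-incident w i)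
    ; cclose    = subst₂ (λ x g → x ∈ E H g) (sym (vertexAt-last w)) (sym (closedEdgeAt-last w e)) b∈
                , subst (λ g → a ∈ E H g) (sym (closedEdgeAt-last w e)) a∈
    }

longer-than-longest : ∀ {H K l} (P : BergePath H K) (Q : BergePath H l) → IsLongest P → K ≤ l → IsLongest Q
longer-than-longest P Q P-longest K≤l l′ Q′ = ≤-trans (P-longest l′ Q′) K≤l

startEdges-defining : ∀ {H K l} (P : BergePath H K) (Q : BergePath H l) →
                      TerminalEdgesDefining H → IsLongest P → K ≤ l → (∀ i → IsDefiningEdge P (edge Q i)) →
                      ∀ g → vert Q zero ∈ E H g → IsDefiningEdge P g
startEdges-defining P Q terminal P-longest K≤l Q-on-P g start∈g
  with terminal _ Q (longer-than-longest P Q P-longest K≤l) _ g (inj₁ refl) start∈g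
... | i , refl = Q-on-P i

clamp : ∀ n → ℕ → Fin (suc n)
clamp n       zero    = zero
clamp zero    (suc j) = zero
clamp (suc n) (suc j) = suc (clamp n j)

toℕ-clamp : ∀ {n j} → j ≤ n → toℕ (clamp n j) ≡ j
toℕ-clamp {n}     {zero}  _         = refl
toℕ-clamp {suc n} {suc j} (s≤s j≤n) = cong suc (toℕ-clamp j≤n)

clamp-toℕ : ∀ n (i : Fin (suc n)) → clamp n (toℕ i) ≡ i
clamp-toℕ n       zero    = refl
clamp-toℕ (suc n) (suc i) = cong suc (clamp-toℕ n i)

clamp-inject₁ : ∀ {n j} → j ≤ n → clamp (suc n) j ≡ inject₁ (clamp n j)
clamp-inject₁ {n}     {zero}  _         = refl
clamp-inject₁ {suc n} {suc j} (s≤s j≤n) = cong suc (clamp-inject₁ j≤n)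

module IndexedPath {H : Hypergraph} {k : ℕ} (P : BergePath H (suc k)) where

  open Walks H

  private
    V  = Fin (n H)
    Ed = Fin (m H)
    K  = suc k

  -- P read along ℕ: v j is the vertex v_j and f j the edge e_{j+1} of the statement, so W lists as
  -- map v (range 1 K). Indices past the end are clamped; v and f follow P only for j ≤ K, resp. j < K.
  v : ℕ → V
  v j = vert P (clamp K j)

  f : ℕ → Ed
  f j = edge P (clamp k j)

  vert≡v : ∀ i → vert P i ≡ v (toℕ i)
  vert≡v i = cong (vert P) (sym (clamp-toℕ K i))

  edge≡f : ∀ i → edge P i ≡ f (toℕ i)
  edge≡f i = cong (edge P) (sym (clamp-toℕ k i))

  v-injective : ∀ {x y} → x ℕ.< suc K → y ℕ.< suc K → v x ≡ v y → x ≡ y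
  v-injective (s≤s x≤K) (s≤s y≤K) vx≡vy =
    trans (sym (toℕ-clamp x≤K)) (trans (cong toℕ (vert-inj P vx≡vy)) (toℕ-clamp y≤K))

  f-injective : ∀ {x y} → x ℕ.< K → y ℕ.< K → f x ≡ f y → x ≡ y
  f-injective (s≤s x≤k) (s≤s y≤k) fx≡fy =
    trans (sym (toℕ-clamp x≤k)) (trans (cong toℕ (edge-inj P fx≡fy)) (toℕ-clamp y≤k))

  incident : ∀ {j} → j ℕ.< K → v j ∈ E H (f j) × v (suc j) ∈ E H (f j)
  incident {j} (s≤s j≤k) =
    subst (λ x → vert P x ∈ E H (f j)) (sym (clamp-inject₁ j≤k)) (proj₁ (inc P (clamp k j))) ,
    proj₂ (inc P (clamp k j))

  v-suc∈W : ∀ j → InW P (v (suc j))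
  v-suc∈W j = clamp k j , refl

  f-defining : ∀ j → IsDefiningEdge P (f j)
  f-defining j = clamp k j , refl

  Unique-vertices : ∀ {vs a d} → a + d ≤ suc K → vs ↭ map v (range a d) → Unique vs
  Unique-vertices a+d≤ vs↭ = Unique-resp-↭ (↭-sym vs↭) (Unique-map-range v v-injective _ _ a+d≤)

  Unique-edges : ∀ {es a d} → a + d ≤ K → es ↭ map f (range a d) → Unique es
  Unique-edges a+d≤ es↭ = Unique-resp-↭ (↭-sym es↭) (Unique-map-range f f-injective _ _ a+d≤)

  Unique-fresh∷W : ∀ {u vs} → ¬ InW P u → vs ↭ map v (range 1 K) → Unique (u ∷ vs)
  Unique-fresh∷W u∉W vs↭ = All.tabulate fresh ∷ Unique-vertices ≤-refl vs↭
    where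
    fresh : ∀ {x} → x ∈ˡ _ → _ ≢ x
    fresh x∈vs u≡x with ∈-map⁻ v (∈-resp-↭ vs↭ x∈vs)
    ... | suc j , _ , refl = u∉W (subst (InW P) (sym u≡x) (v-suc∈W j))
    ... | zero , j∈ , _ with () ← proj₁ (∈-range⁻ 1 K j∈)

  ∈-map-f⇒defining : ∀ {g js} → g ∈ˡ map f js → IsDefiningEdge P g
  ∈-map-f⇒defining g∈ with ∈-map⁻ f g∈
  ... | j , _ , refl = f-defining j

  segment : ∀ a d → a + d ≤ K → Walk (v a) (v (a + d)) (map v (range (suc a) d)) (map f (range a d))
  segment a zero    _ rewrite +-identityʳ a = []
  segment a (suc d) a+d<K rewrite +-suc a d =
    step (proj₁ (incident a<K)) (proj₂ (incident a<K)) (segment (suc a) d a+d<K)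
    where
    a<K : a ℕ.< K
    a<K = ≤-trans (s≤s (m≤m+n a d)) a+d<K

  rotation : ∀ {z} i → i ℕ.< K → z ∈ E H (f 0) →
             ∃[ w ] w ∈ E H (f i) × Walk z w (map v (range 1 i)) (map f (range 0 i))
  rotation zero    _   z∈f₀ = _ , z∈f₀ , []
  rotation (suc i) i<K z∈f₀ =
    v (suc i) , proj₁ (incident i<K) , step z∈f₀ (proj₂ (incident (s≤s z≤n))) (segment 1 i (<⇒≤ i<K))

  -- A walk on the vertices W ∪ {fresh} and on the edges of P, each used once: its path is as long
  -- as P, hence again longest.
  record Rerouting {x y vs es} (w : Walk x y vs es) : Set where
    field
      fresh     : V
      fresh∉W   : ¬ InW P fresh
      vertices↭ : x ∷ vs ↭ fresh ∷ map v (range 1 K)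
      edges↭    : es ↭ map f (range 0 K)

  module _ {x y vs es} {w : Walk x y vs es} (R : Rerouting w) where
    open Rerouting R

    reroutedPath : BergePath H (length es)
    reroutedPath = toPath w (Unique-resp-↭ (↭-sym vertices↭) (Unique-fresh∷W fresh∉W ↭-refl)) (Unique-edges ≤-refl edges↭)

    reroutedPath-long : K ≤ length es
    reroutedPath-long = ≤-reflexive (sym (trans (↭-length edges↭) (trans (length-map f (range 0 K)) (length-range 0 K))))

    reroutedPath-longest : IsLongest P → IsLongest reroutedPath
    reroutedPath-longest P-longest = longer-than-longest P reroutedPath P-longest reroutedPath-long

    reroutedPath-on-P : ∀ i → IsDefiningEdge P (edge reroutedPath i)
    reroutedPath-on-P i = ∈-map-f⇒defining {js = range 0 K} (∈-resp-↭ edges↭ (edgeAt-∈ w i))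

  Rerouted : V → Set
  Rerouted x = ∃[ y ] ∃[ vs ] ∃[ es ] Σ (Walk x y vs es) Rerouting

  ReroutedThrough : V → Ed → Set
  ReroutedThrough x e = ∃[ y ] ∃[ vs ] ∃[ es ] Σ (Walk x y vs (e ∷ es)) Rerouting

  rerouted-startEdges : ∀ {x} → TerminalEdgesDefining H → IsLongest P → Rerouted x →
                        ∀ g → x ∈ E H g → IsDefiningEdge P g
  rerouted-startEdges terminal P-longest (_ , _ , _ , _ , R) =
    startEdges-defining P (reroutedPath R) terminal P-longest (reroutedPath-long R) (reroutedPath-on-P R)

  reroutedThrough⇒rerouted : ∀ {x e} → ReroutedThrough x e → Rerouted x
  reroutedThrough⇒rerouted (y , vs , es , w , R) = y , vs , _ , w , R

  reroutedThrough-firstEdge : ∀ {x e} → IsLongest P → ReroutedThrough x e → IsFirstEdgeOfLongest H e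
  reroutedThrough-firstEdge P-longest (_ , _ , _ , w , R) =
    _ , reroutedPath R , reroutedPath-longest R P-longest , edgeAt-zero w

  -- u, f i, v i, …, v 1, f 0, v (i+1), f (i+1), …, v K
  rerouting-through-edge : ∀ {u i} → i ℕ.< K → v (suc i) ∈ E H (f 0) → u ∈ E H (f i) → ¬ InW P u →
                           ReroutedThrough u (f i)
  rerouting-through-edge {u} {i} i<K vᵢ₊₁∈f₀ u∈fᵢ u∉W with m≤n⇒∃[o]m+o≡n (≤-pred i<K)
  ... | d , i+d≡k with rotation i i<K vᵢ₊₁∈f₀
  ... | w , w∈fᵢ , rot with reverseʷ rot
  ... | vs′ , es′ , back , vs′↭ , es′↭ =
    _ , _ , _ , step u∈fᵢ w∈fᵢ (back ++ʷ segment (suc i) d (s≤s (≤-reflexive i+d≡k))) , record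
      { fresh     = u
      ; fresh∉W   = u∉W
      ; vertices↭ = prep u (↭-trans (↭-range-++ v refl (↭-trans vs′↭ (↭-range-∷ v 1 i)) ↭-refl) total)
      ; edges↭    = ↭-trans (↭-range-++ f refl (↭-trans (prep (f i) es′↭) (↭-range-∷ f 0 i)) ↭-refl) total
      }
    where
    total : ∀ {A} {g : ℕ → A} {a} → map g (range a (suc i + d)) ↭ map g (range a K)
    total {g = g} {a} = ↭-reflexive (cong (map g ∘ range a ∘ suc) i+d≡k)

  vertex-blocks : ∀ {i d₁ d₂ xs ys zs} → suc i + d₁ + d₂ ≡ k →
                  xs ↭ map v (range (suc i) (suc d₁)) → ys ↭ map v (range 1 i) →
                  zs ↭ map v (range (suc (suc i + d₁)) (suc d₂)) → xs ++ (ys ++ zs) ↭ map v (range 1 K)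
  vertex-blocks {i} {d₁} {d₂} {xs} {ys} {zs} eq xs↭ ys↭ zs↭ = begin
    xs ++ (ys ++ zs)                         ≡⟨ ++-assoc xs ys zs ⟨
    (xs ++ ys) ++ zs                         ↭⟨ ↭-range-++ v (cong suc (+-suc i d₁)) (↭-range-++ᶜ v refl ys↭ xs↭) zs↭ ⟩
    map v (range 1 ((i + suc d₁) + suc d₂))  ≡⟨ cong (map v ∘ range 1) (trans length≡ (cong suc eq)) ⟩
    map v (range 1 K)                        ∎
    where
    open PermutationReasoning
    length≡ : (i + suc d₁) + suc d₂ ≡ suc (suc i + d₁ + d₂)
    length≡ = trans (+-suc (i + suc d₁) d₂) (cong (λ n → suc (n + d₂)) (+-suc i d₁))

  edge-blocks : ∀ {i d₁ d₂ xs ys zs} → suc i + d₁ + d₂ ≡ k →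
                xs ↭ map f (range (suc i) d₁) → ys ↭ map f (range 0 (suc i)) →
                zs ↭ map f (range (suc i + d₁) (suc d₂)) → xs ++ (ys ++ zs) ↭ map f (range 0 K)
  edge-blocks {i} {d₁} {d₂} {xs} {ys} {zs} eq xs↭ ys↭ zs↭ = begin
    xs ++ (ys ++ zs)                         ≡⟨ ++-assoc xs ys zs ⟨
    (xs ++ ys) ++ zs                         ↭⟨ ↭-range-++ f refl (↭-range-++ᶜ f refl ys↭ xs↭) zs↭ ⟩
    map f (range 0 ((suc i + d₁) + suc d₂))  ≡⟨ cong (map f ∘ range 0) (trans (+-suc _ d₂) (cong suc eq)) ⟩
    map f (range 0 K)                        ∎
    where open PermutationReasoning

  -- v j, …, v (i+1), f 0, v 1, …, v i, f i, u, f j, v (j+1), …, v K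
  rerouting-from-vⱼ : ∀ {u i j} → i ℕ.< j → j ℕ.< K → v (suc i) ∈ E H (f 0) →
                      u ∈ E H (f i) → u ∈ E H (f j) → ¬ InW P u → Rerouted (v j)
  rerouting-from-vⱼ {u} {i} i<j j<K vᵢ₊₁∈f₀ u∈fᵢ u∈fⱼ u∉W
    with m≤n⇒∃[o]m+o≡n i<j | m≤n⇒∃[o]m+o≡n (≤-pred j<K)
  ... | d₁ , refl | d₂ , eq
    with reverseʷ (segment (suc i) d₁ (<⇒≤ j<K)) | rotation i (<-trans i<j j<K) vᵢ₊₁∈f₀
  ... | vs₁ , es₁ , back , vs₁↭ , es₁↭ | w , w∈fᵢ , rot =
    _ , _ , _ , back ++ʷ rot ++ʷ step w∈fᵢ u∈fᵢ (step u∈fⱼ (proj₂ (incident j<K)) (segment _ d₂ (s≤s (≤-reflexive eq)))) ,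
    record
      { fresh     = u
      ; fresh∉W   = u∉W
      ; vertices↭ = begin
          A ++ (B ++ (u ∷ C))  ↭⟨ ++⁺ˡ A (shift u B C) ⟩
          A ++ (u ∷ (B ++ C))  ↭⟨ shift u A (B ++ C) ⟩
          u ∷ (A ++ (B ++ C))  ↭⟨ prep u (vertex-blocks eq vs₁↭ ↭-refl ↭-refl) ⟩
          u ∷ map v (range 1 K) ∎
      ; edges↭    = begin
          es₁ ++ (Aₑ ++ (f i ∷ Z))  ↭⟨ ++⁺ˡ es₁ (shift (f i) Aₑ Z) ⟩
          es₁ ++ ((f i ∷ Aₑ) ++ Z)  ↭⟨ edge-blocks eq es₁↭ (↭-range-∷ f 0 i) ↭-refl ⟩
          map f (range 0 K)         ∎
      }
    where
    open PermutationReasoning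
    j = suc i + d₁
    A = v j ∷ vs₁
    B = map v (range 1 i)
    C = map v (range (suc j) (suc d₂))
    Aₑ = map f (range 0 i)
    Z = map f (range j (suc d₂))

  -- v (i+1), …, v j, f j, u, f i, v i, …, v 1, f 0, v (j+1), …, v K
  rerouting-from-vᵢ₊₁ : ∀ {u i j} → i ℕ.< j → j ℕ.< K → v (suc j) ∈ E H (f 0) →
                        u ∈ E H (f i) → u ∈ E H (f j) → ¬ InW P u → Rerouted (v (suc i))
  rerouting-from-vᵢ₊₁ {u} {i} i<j j<K vⱼ₊₁∈f₀ u∈fᵢ u∈fⱼ u∉W
    with m≤n⇒∃[o]m+o≡n i<j | m≤n⇒∃[o]m+o≡n (≤-pred j<K)
  ... | d₁ , refl | d₂ , eq with rotation i (<-trans i<j j<K) vⱼ₊₁∈f₀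
  ... | w , w∈fᵢ , rot with reverseʷ rot
  ... | vs₂ , es₂ , back , vs₂↭ , es₂↭ =
    _ , _ , _ ,
    segment (suc i) d₁ (<⇒≤ j<K) ++ʷ
      step (proj₁ (incident j<K)) u∈fⱼ (step u∈fᵢ w∈fᵢ (back ++ʷ segment (suc j) d₂ (s≤s (≤-reflexive eq)))) ,
    record
      { fresh     = u
      ; fresh∉W   = u∉W
      ; vertices↭ = begin
          A ++ (u ∷ ((w ∷ vs₂) ++ T))       ↭⟨ shift u A _ ⟩
          u ∷ (A ++ ((w ∷ vs₂) ++ T))       ↭⟨ prep u (++⁺ˡ A (++⁺ʳ T vs₂↭)) ⟩
          u ∷ (A ++ ((v (suc j) ∷ B) ++ T))  ↭⟨ prep u (++⁺ˡ A (↭-sym (shift (v (suc j)) B T))) ⟩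
          u ∷ (A ++ (B ++ (v (suc j) ∷ T)))  ↭⟨ prep u (vertex-blocks eq ↭-refl ↭-refl ↭-refl) ⟩
          u ∷ map v (range 1 K)             ∎
      ; edges↭    = begin
          X ++ (f j ∷ ((f i ∷ es₂) ++ Zₜ))  ↭⟨ ++⁺ˡ X (↭-sym (shift (f j) (f i ∷ es₂) Zₜ)) ⟩
          X ++ ((f i ∷ es₂) ++ (f j ∷ Zₜ))  ↭⟨ edge-blocks eq ↭-refl (↭-trans (prep (f i) es₂↭) (↭-range-∷ f 0 i)) ↭-refl ⟩
          map f (range 0 K)                 ∎
      }
    where
    open PermutationReasoning
    j = suc i + d₁
    A = map v (range (suc i) (suc d₁))
    B = map v (range 1 i)
    T = map v (range (suc (suc j)) d₂)
    X = map f (range (suc i) d₁)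
    Zₜ = map f (range (suc j) d₂)

  -- With t the last index such that v t ∈ f i, the cycle v t, …, v (i+1), f 0, v 1, …, v i, f i
  -- passes through every vertex of f i.
  covered-edge-cycle : ∀ {r i} → Uniform r H → i ℕ.< K → v (suc i) ∈ E H (f 0) →
                       (∀ x → x ∈ E H (f i) → InW P x) → HasCycleAtLeast H r
  covered-edge-cycle {r} {i} uniform i<K vᵢ₊₁∈f₀ fᵢ⊆W
    with lastWitness (λ s → v s ∈? E H (f i)) K i<K (proj₂ (incident i<K))
  ... | t , i<t , t≤K , vₜ∈fᵢ , last with m≤n⇒∃[o]m+o≡n i<t
  ... | d , refl with reverseʷ (segment (suc i) d t≤K) | rotation i i<K vᵢ₊₁∈f₀
  ... | vs₁ , es₁ , back , vs₁↭ , es₁↭ | w , w∈fᵢ , rot =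
    _ , r≤ , toCycle (back ++ʷ rot) w∈fᵢ vₜ∈fᵢ (Unique-vertices (s≤s t≤K) vertices↭) (Unique-edges t≤K edges↭)
    where
    vertices↭ : (v t ∷ vs₁) ++ map v (range 1 i) ↭ map v (range 1 t)
    vertices↭ = ↭-trans (↭-range-++ᶜ v refl ↭-refl vs₁↭) (↭-reflexive (cong (map v ∘ range 1) (+-suc i d)))

    edges↭ : (f i ∷ es₁) ++ map f (range 0 i) ↭ map f (range 0 t)
    edges↭ = ↭-trans (↭-range-++ᶜ f refl ↭-refl (prep (f i) es₁↭)) (↭-reflexive (cong (map f ∘ range 0) (+-suc i d)))

    fᵢ⊆cycle : ∀ {x} → x ∈ E H (f i) → x ∈ˡ (v t ∷ vs₁) ++ map v (range 1 i)
    fᵢ⊆cycle x∈fᵢ with fᵢ⊆W _ x∈fᵢ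
    ... | s , refl = ∈-resp-↭ (↭-sym vertices↭) (subst (_∈ˡ map v (range 1 t)) (sym (vert≡v (suc s)))
                       (∈-map⁺ v (∈-range⁺ 1 t (s≤s z≤n) (s≤s s≤t))))
      where
      s≤t : suc (toℕ s) ≤ t
      s≤t = ≮⇒≥ λ t<s → last t<s (toℕ<n s) (subst (_∈ E H (f i)) (vert≡v (suc s)) x∈fᵢ)

    r≤ : r ≤ suc (length (es₁ ++ map f (range 0 i)))
    r≤ = begin
      r                                              ≡⟨ uniform (f i) ⟨
      ∣ E H (f i) ∣                                  ≤⟨ ∣p∣≤length _ fᵢ⊆cycle ⟩
      length (v t ∷ vs₁ ++ map v (range 1 i))        ≡⟨ cong suc (length-vertices (back ++ʷ rot)) ⟩
      suc (length (es₁ ++ map f (range 0 i)))        ∎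
      where open ≤-Reasoning

  private
    vert-suc∈ : ∀ {i g} → vert P (suc i) ∈ E H g → v (suc (toℕ i)) ∈ E H g
    vert-suc∈ {i} = subst (_∈ E H _) (vert≡v (suc i))

    ∈edge : ∀ {x i} → x ∈ E H (edge P i) → x ∈ E H (f (toℕ i))
    ∈edge {x} {i} = subst (λ g → x ∈ E H g) (edge≡f i)

  covered-edge⇒cycle : ∀ {r} → Uniform r H → (i : Fin K) → vert P (suc i) ∈ E H (edge P zero) →
                       (∀ x → x ∈ E H (edge P i) → InW P x) → HasCycleAtLeast H r
  covered-edge⇒cycle uniform i vᵢ₊₁∈e₀ eᵢ⊆W =
    covered-edge-cycle uniform (toℕ<n i) (vert-suc∈ vᵢ₊₁∈e₀) (λ x → eᵢ⊆W x ∘ subst (λ g → x ∈ E H g) (sym (edge≡f i)))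

  module _ (terminal : TerminalEdgesDefining H) (P-longest : IsLongest P) where

    exposed-edge⇒first-edge∧nbhd :
      (i : Fin K) → vert P (suc i) ∈ E H (edge P zero) → ∃[ x ] (x ∈ E H (edge P i) × ¬ InW P x) →
      IsFirstEdgeOfLongest H (edge P i) × NbhdInPath P (λ x → x ∈ E H (edge P i) × ¬ InW P x)
    exposed-edge⇒first-edge∧nbhd i vᵢ₊₁∈e₀ (x , x∈eᵢ , x∉W) =
      subst (IsFirstEdgeOfLongest H) (sym (edge≡f i)) (reroutedThrough-firstEdge P-longest (through x∈eᵢ x∉W)) ,
      λ g (y , (y∈eᵢ , y∉W) , y∈g) →
        rerouted-startEdges terminal P-longest (reroutedThrough⇒rerouted (through y∈eᵢ y∉W)) g y∈g
      where
      through : ∀ {u} → u ∈ E H (edge P i) → ¬ InW P u → ReroutedThrough u (f (toℕ i))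
      through u∈eᵢ = rerouting-through-edge (toℕ<n i) (vert-suc∈ vᵢ₊₁∈e₀) (∈edge u∈eᵢ)

    shared-outsider⇒nbhd-vⱼ :
      (i j : Fin K) → i < j → vert P (suc i) ∈ E H (edge P zero) →
      ∃[ x ] (x ∈ E H (edge P i) × x ∈ E H (edge P j) × ¬ InW P x) →
      NbhdInPath P (λ x → vert P (inject₁ j) ≡ x)
    shared-outsider⇒nbhd-vⱼ i j i<j vᵢ₊₁∈e₀ (u , u∈eᵢ , u∈eⱼ , u∉W) g (_ , refl , vⱼ∈g) =
      rerouted-startEdges terminal P-longest
        (rerouting-from-vⱼ i<j (toℕ<n j) (vert-suc∈ vᵢ₊₁∈e₀) (∈edge u∈eᵢ) (∈edge u∈eⱼ) u∉W)
        g (subst (_∈ E H g) (trans (vert≡v (inject₁ j)) (cong v (toℕ-inject₁ j))) vⱼ∈g)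

    shared-outsider⇒nbhd-vᵢ₊₁ :
      (i j : Fin K) → i < j → vert P (suc j) ∈ E H (edge P zero) →
      ∃[ x ] (x ∈ E H (edge P i) × x ∈ E H (edge P j) × ¬ InW P x) →
      NbhdInPath P (λ x → vert P (suc i) ≡ x)
    shared-outsider⇒nbhd-vᵢ₊₁ i j i<j vⱼ₊₁∈e₀ (u , u∈eᵢ , u∈eⱼ , u∉W) g (_ , refl , vᵢ₊₁∈g) =
      rerouted-startEdges terminal P-longest
        (rerouting-from-vᵢ₊₁ i<j (toℕ<n j) (vert-suc∈ vⱼ₊₁∈e₀) (∈edge u∈eᵢ) (∈edge u∈eⱼ) u∉W)
        g (vert-suc∈ vᵢ₊₁∈g)

lemma3p6 : (r : ℕ) (H : Hypergraph) → Uniform r H → TerminalEdgesDefining H →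
    (k : ℕ) (P : BergePath H (suc k)) → IsLongest P →
    ((∀ (i : Fin (suc k)) → vert P (suc i) ∈ E H (edge P zero) →
        (∀ x → x ∈ E H (edge P i) → InW P x) → HasCycleAtLeast H r)
    × (∀ (i : Fin (suc k)) → vert P (suc i) ∈ E H (edge P zero) →
        (∃[ x ] (x ∈ E H (edge P i) × ¬ InW P x)) →
        IsFirstEdgeOfLongest H (edge P i)
        × NbhdInPath P (λ x → x ∈ E H (edge P i) × ¬ InW P x))
    × (∀ (i j : Fin (suc k)) → i < j → vert P (suc i) ∈ E H (edge P zero) →
        (∃[ x ] (x ∈ E H (edge P i) × x ∈ E H (edge P j) × ¬ InW P x)) →
        NbhdInPath P (λ x → vert P (inject₁ j) ≡ x))
    × (∀ (i j : Fin (suc k)) → i < j → vert P (suc j) ∈ E H (edge P zero) →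
        (∃[ x ] (x ∈ E H (edge P i) × x ∈ E H (edge P j) × ¬ InW P x)) →
        NbhdInPath P (λ x → vert P (suc i) ≡ x)))
lemma3p6 r H uniform terminal k P P-longest =
    covered-edge⇒cycle uniform
  , exposed-edge⇒first-edge∧nbhd terminal P-longest
  , shared-outsider⇒nbhd-vⱼ terminal P-longest
  , shared-outsider⇒nbhd-vᵢ₊₁ terminal P-longest
  where open IndexedPath P
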